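{- For all integers $1\le j\le k$ we have $(j+1)\,d([k-j])\le 2\,d([k-1])$. Equality holds if and only if $j=1$, or $k=3$ and $j=2$.
   Context: $\mathbb{N}=\{0,1,2,\ldots\}$, $[k]=\{0,1,\ldots,k\}$, $A+B=\{a+b:a\in A,b\in B\}$. For a finite set $C\subseteq\mathbb{N}$, $d(C)$ is the number of sets $A\subseteq\mathbb{N}$ for which there exists $B\subseteq\mathbb{N}$ with $C=A+B$. -}

module Defs where

open import Data.Nat using (ℕ; zero; suc; _+_)
open import Data.Fin using (Fin; toℕ)
open import Data.Fin.Subset using (Subset; _∈_; ⊤; inside; outside)
open import Data.Fin.Subset.Properties using (_∈?_; anySubset?)
open import Data.Fin.Properties using (any?; all?)
open import Data.Vec using (_∷_; [])
open import Data.List using (List; [_]; map; _++_; filter; length)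
open import Data.Product using (_×_; _,_; ∃)
open import Relation.Nullary using (Dec)
open import Relation.Nullary.Decidable using (_×-dec_; _→-dec_)
open import Relation.Binary.PropositionalEquality using (_≡_)
import Data.Nat.Properties as ℕP

-- Finite subsets of ℕ contained in {0,…,n-1} are represented as Subset n,
-- element i : Fin n standing for the natural number toℕ i.

IsSumset : ∀ {n} → Subset n → Subset n → Subset n → Set
IsSumset {n} A B C =
  (∀ (a b : Fin n) → a ∈ A → b ∈ B →
     ∃ λ (c : Fin n) → c ∈ C × toℕ a + toℕ b ≡ toℕ c)
  × (∀ (c : Fin n) → c ∈ C →
     ∃ λ (a : Fin n) → ∃ λ (b : Fin n) → a ∈ A × b ∈ B × toℕ a + toℕ b ≡ toℕ c)

isSumset? : ∀ {n} (A B C : Subset n) → Dec (IsSumset A B C)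
isSumset? A B C =
  all? (λ a → all? (λ b → (a ∈? A) →-dec ((b ∈? B) →-dec
    any? (λ c → (c ∈? C) ×-dec (toℕ a + toℕ b ℕP.≟ toℕ c)))))
  ×-dec
  all? (λ c → (c ∈? C) →-dec
    any? (λ a → any? (λ b → (a ∈? A) ×-dec ((b ∈? B) ×-dec (toℕ a + toℕ b ℕP.≟ toℕ c)))))

IsSummand : ∀ {n} → Subset n → Subset n → Set
IsSummand {n} C A = ∃ λ (B : Subset n) → IsSumset A B C

isSummand? : ∀ {n} (C A : Subset n) → Dec (IsSummand C A)
isSummand? C A = anySubset? (λ B → isSumset? A B C)

allSubsets : ∀ n → List (Subset n)
allSubsets zero = [ [] ]
allSubsets (suc n) = map (inside ∷_) (allSubsets n) ++ map (outside ∷_) (allSubsets n)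

dSub : ∀ {n} → Subset n → ℕ
dSub C = length (filter (isSummand? C) (allSubsets _))

-- d([m]) where [m] = {0,1,…,m}; any A with A + B = [m] satisfies A ⊆ [m].
d[_] : ℕ → ℕ
d[ m ] = dSub {suc m} ⊤

-- If A + B = [0, m] then 0 ∈ A and B ⊆ [0, m − max A], so A is a summand of [0, m]
-- exactly when A + [0, m − max A] = [0, m]. Call such an A slack if its maximum is already
-- covered by a smaller element of A, and tight otherwise. Three injections compare the
-- summands of [0, m] and [0, m + 1]: adding max A + 1 sends every summand to one whose two
-- largest elements are adjacent; moving the maximum up by one sends slack summands to ones
-- whose two largest elements are not adjacent; moving it down by one sends tight summands to
-- slack ones, and misses [0, m − 1] when m ≥ 2. With d = s + t (slack plus tight) and t ≤ s
-- this gives d(m + 1) ≥ d(m) + s, hence 3 d(m) ≤ 2 d(m + 1), strictly unless m = 1.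
-- Combining consecutive steps yields (j + 1) d(k − j) ≤ 2 d(k − 1) by induction on j,
-- strictly once j ≥ 3.

module Submission where

open import Defs
open import Data.Nat using (ℕ; zero; suc; pred; _+_; _*_; _∸_; _≤_; _<_; z≤n; s≤s; z<s)
open import Data.Nat.Properties
open import Data.Nat.Tactic.RingSolver using (solve-∀)
open import Data.Bool using (Bool; true; false; _∨_; if_then_else_)
import Data.Bool.Properties as Bool
open import Data.Fin using (toℕ; fromℕ<) renaming (zero to fzero; suc to fsuc)
open import Data.Fin.Properties using (toℕ<n; toℕ-fromℕ<)
open import Data.Fin.Subset using (Subset; Side; inside; outside; _∈_; ⊤) renaming (⊥ to ∅)
open import Data.Fin.Subset.Properties using (∈⊤)
open import Data.Vec using ([]; _∷_; _∷ʳ_; here; there)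
open import Data.Vec.Properties using (∷-injective; ∷-injectiveʳ; ∷ʳ-injectiveˡ)
open import Data.List using (List; []; _∷_; map; filter; length)
open import Data.List.Properties using (length-map)
open import Data.List.Membership.Propositional using () renaming (_∈_ to _∈ˡ_)
open import Data.List.Membership.Propositional.Properties
  using (∈-filter⁺; ∈-filter⁻; ∈-map⁺; ∈-map⁻; ∈-++⁺ˡ; ∈-++⁺ʳ)
open import Data.List.Relation.Unary.Any using (here; there)
open import Data.List.Relation.Unary.All using (All; []; _∷_; lookup; tabulate)
open import Data.List.Relation.Unary.Unique.Propositional using (Unique; []; _∷_)
import Data.List.Relation.Unary.Unique.Propositional.Properties as Unique
open import Data.Empty using (⊥; ⊥-elim)
open import Data.Product using (Σ-syntax; ∃-syntax; _×_; _,_; proj₂)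
open import Data.Sum using (_⊎_; inj₁; inj₂; [_,_]′)
open import Function using (_∘_; _∘′_)
open import Function.Bundles using (_⇔_; mk⇔; Equivalence)
open import Level using (0ℓ)
open import Relation.Nullary using (¬_; yes; no; contradiction)
open import Relation.Nullary.Decidable using (_×-dec_; _⊎-dec_; decidable-stable)
open import Relation.Unary using (Pred; Decidable; _∩_; ∁)
open import Relation.Unary.Properties using (_∩?_; ∁?)
open import Relation.Binary.PropositionalEquality

private variable
  S T : Set
  m n n′ c x y : ℕ

-- Counting subsets

∈-remove : ∀ {x : S} {ys} → x ∈ˡ ys →
  Σ[ zs ∈ List S ] length ys ≡ suc (length zs) × (∀ {y} → y ∈ˡ ys → y ≢ x → y ∈ˡ zs)
∈-remove {ys = _ ∷ ys} (here refl) = ys , refl , λ where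
  (here y≡x) y≢x → ⊥-elim (y≢x y≡x)
  (there y∈)  _  → y∈
∈-remove {ys = y ∷ _} (there x∈) with ∈-remove x∈
... | zs , |ys|≡ , sub = y ∷ zs , cong suc |ys|≡ , λ where
  (here refl) _  → here refl
  (there y∈) y≢x → there (sub y∈ y≢x)

unique-⊆⇒length-≤ : ∀ {xs ys : List S} → Unique xs → (∀ {x} → x ∈ˡ xs → x ∈ˡ ys) →
                    length xs ≤ length ys
unique-⊆⇒length-≤ {xs = []} _ _ = z≤n
unique-⊆⇒length-≤ {xs = x ∷ xs} (x∉xs ∷ xs!) xs⊆ys with ∈-remove (xs⊆ys (here refl))
... | zs , |ys|≡ , sub = subst (suc (length xs) ≤_) (sym |ys|≡) (s≤s (unique-⊆⇒length-≤ xs! λ y∈ →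
  sub (xs⊆ys (there y∈)) λ where refl → lookup x∉xs y∈ refl))

map⁺-unique : ∀ (f : S → T) {xs} → Unique xs →
              (∀ {x y} → x ∈ˡ xs → y ∈ˡ xs → f x ≡ f y → x ≡ y) → Unique (map f xs)
map⁺-unique f {[]} _ _ = []
map⁺-unique f {x ∷ xs} (x∉xs ∷ xs!) inj =
  images-distinct x∉xs (λ y∈ → inj (here refl) (there y∈))
  ∷ map⁺-unique f xs! (λ p q → inj (there p) (there q))
  where
  images-distinct : ∀ {ys} → All (x ≢_) ys → (∀ {y} → y ∈ˡ ys → f x ≡ f y → x ≡ y) →
                    All (f x ≢_) (map f ys)
  images-distinct [] _ = []
  images-distinct (x≢y ∷ x∉ys) inj′ =
    (λ fx≡fy → x≢y (inj′ (here refl) fx≡fy)) ∷ images-distinct x∉ys (inj′ ∘′ there)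

allSubsets-complete : ∀ n (A : Subset n) → A ∈ˡ allSubsets n
allSubsets-complete zero    []           = here refl
allSubsets-complete (suc n) (inside ∷ A)  = ∈-++⁺ˡ (∈-map⁺ (inside ∷_) (allSubsets-complete n A))
allSubsets-complete (suc n) (outside ∷ A) =
  ∈-++⁺ʳ (map (inside ∷_) (allSubsets n)) (∈-map⁺ (outside ∷_) (allSubsets-complete n A))

allSubsets-unique : ∀ n → Unique (allSubsets n)
allSubsets-unique zero    = [] ∷ []
allSubsets-unique (suc n) =
  Unique.++⁺ (Unique.map⁺ ∷-injectiveʳ (allSubsets-unique n))
             (Unique.map⁺ ∷-injectiveʳ (allSubsets-unique n))
             λ (p , q) → heads-differ (∈-map⁻ (inside ∷_) p) (∈-map⁻ (outside ∷_) q)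
  where
  heads-differ : ∀ {C : Subset (suc n)} → ∃[ A ] A ∈ˡ allSubsets n × C ≡ inside ∷ A →
                 ∃[ B ] B ∈ˡ allSubsets n × C ≡ outside ∷ B → ⊥
  heads-differ (_ , _ , refl) (_ , _ , ())

count : {P : Pred (Subset n) 0ℓ} → Decidable P → ℕ
count P? = length (filter P? (allSubsets _))

module _ {P : Pred (Subset n) 0ℓ} {Q : Pred (Subset n′) 0ℓ} (P? : Decidable P) (Q? : Decidable Q)
         (f : Subset n → Subset n′) (f-maps : ∀ {A} → P A → Q (f A))
         (f-injective : ∀ {A B} → P A → P B → f A ≡ f B → A ≡ B) where

  private
    image = map f (filter P? (allSubsets n))

    selected : ∀ {A} → A ∈ˡ filter P? (allSubsets n) → P A
    selected A∈ = proj₂ (∈-filter⁻ P? {xs = allSubsets n} A∈)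

    image-unique : Unique image
    image-unique = map⁺-unique f (Unique.filter⁺ P? (allSubsets-unique n)) λ x∈ y∈ →
      f-injective (selected x∈) (selected y∈)

    image-⊆ : ∀ {C} → C ∈ˡ image → C ∈ˡ filter Q? (allSubsets n′)
    image-⊆ C∈ with ∈-map⁻ f C∈
    ... | A , A∈ , refl = ∈-filter⁺ Q? (allSubsets-complete n′ (f A)) (f-maps (selected A∈))

  count-≤ : count P? ≤ count Q?
  count-≤ = subst (_≤ count Q?) (length-map f (filter P? (allSubsets n)))
    (unique-⊆⇒length-≤ image-unique image-⊆)

  count-< : ∀ {C} → Q C → (∀ {A} → P A → f A ≢ C) → count P? < count Q?
  count-< {C} qC C∉image = subst (λ k → suc k ≤ count Q?) (length-map f (filter P? (allSubsets n)))
    (unique-⊆⇒length-≤ (tabulate C∉ ∷ image-unique) λ where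
      (here refl) → ∈-filter⁺ Q? (allSubsets-complete n′ C) qC
      (there D∈)  → image-⊆ D∈)
    where
    C∉ : ∀ {D} → D ∈ˡ image → C ≢ D
    C∉ D∈ refl with ∈-map⁻ f D∈
    ... | A , A∈ , C≡fA = C∉image (selected A∈) (sym C≡fA)

count-positive : {P : Pred (Subset n) 0ℓ} (P? : Decidable P) → ∀ {A} → P A → 1 ≤ count P?
count-positive P? {A} pA =
  unique-⊆⇒length-≤ ([] ∷ []) λ where (here refl) → ∈-filter⁺ P? (allSubsets-complete _ A) pA

count-split : {P Q : Pred (Subset n) 0ℓ} (P? : Decidable P) (Q? : Decidable Q) →
              count P? ≡ count (P? ∩? Q?) + count (P? ∩? ∁? Q?)
count-split P? Q? = go (allSubsets _)
  where
  go : ∀ xs → length (filter P? xs) ≡ length (filter (P? ∩? Q?) xs) + length (filter (P? ∩? ∁? Q?) xs)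
  go [] = refl
  go (x ∷ xs) with P? x | Q? x
  ... | yes _ | yes _ = cong suc (go xs)
  ... | yes _ | no  _ = trans (cong suc (go xs)) (sym (+-suc _ _))
  ... | no  _ | _     = go xs

-- Subsets of {0, …, n - 1} as sets of naturals

member : Subset n → ℕ → Bool
member []      _       = false
member (b ∷ _) zero    = b
member (_ ∷ A) (suc x) = member A x

infix 4 _∈ℕ_
_∈ℕ_ : ℕ → Subset n → Set
x ∈ℕ A = member A x ≡ true

∈⇒∈ℕ : ∀ {A : Subset n} {i} → i ∈ A → toℕ i ∈ℕ A
∈⇒∈ℕ here      = refl
∈⇒∈ℕ (there i∈) = ∈⇒∈ℕ i∈

∈ℕ⇒∃∈ : ∀ (A : Subset n) → x ∈ℕ A → ∃[ i ] i ∈ A × toℕ i ≡ x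
∈ℕ⇒∃∈ {x = zero}  (inside ∷ _) refl = fzero , here , refl
∈ℕ⇒∃∈ {x = suc x} (_ ∷ A)      x∈   with ∈ℕ⇒∃∈ A x∈
... | i , i∈ , i≡x = fsuc i , there i∈ , cong suc i≡x

∈ℕ⇒< : ∀ (A : Subset n) → x ∈ℕ A → x < n
∈ℕ⇒< {x = zero}  (_ ∷ _) _  = s≤s z≤n
∈ℕ⇒< {x = suc x} (_ ∷ A) x∈ = s≤s (∈ℕ⇒< A x∈)

≥⇒∉ℕ : ∀ (A : Subset n) → n ≤ x → member A x ≡ false
≥⇒∉ℕ []                    _         = refl
≥⇒∉ℕ {x = suc x} (_ ∷ A) (s≤s n≤x) = ≥⇒∉ℕ A n≤x

∉ℕ-∅ : ∀ {n} x → member (∅ {n}) x ≡ false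
∉ℕ-∅ {zero}  _       = refl
∉ℕ-∅ {suc n} zero    = refl
∉ℕ-∅ {suc n} (suc x) = ∉ℕ-∅ {n} x

all-∈ℕ⇒⊤ : ∀ (A : Subset n) → (∀ {x} → x < n → x ∈ℕ A) → A ≡ ⊤
all-∈ℕ⇒⊤ []      _    = refl
all-∈ℕ⇒⊤ (_ ∷ A) all∈ = cong₂ _∷_ (all∈ (s≤s z≤n)) (all-∈ℕ⇒⊤ A λ x<n → all∈ (s≤s x<n))

hasMember : Subset n → Bool
hasMember []      = false
hasMember (b ∷ A) = b ∨ hasMember A

-- max ∅ = 0.
max : Subset n → ℕ
max []      = 0
max (_ ∷ A) = if hasMember A then suc (max A) else 0

∈ℕ⇒hasMember : ∀ (A : Subset n) → x ∈ℕ A → hasMember A ≡ true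
∈ℕ⇒hasMember {x = zero}  (inside ∷ _)  _  = refl
∈ℕ⇒hasMember {x = suc x} (inside ∷ _)  _  = refl
∈ℕ⇒hasMember {x = suc x} (outside ∷ A) x∈ = ∈ℕ⇒hasMember A x∈

hasMember⇒∈ℕ : ∀ (A : Subset n) → hasMember A ≡ true → ∃[ x ] x ∈ℕ A
hasMember⇒∈ℕ (inside ∷ _)  _ = zero , refl
hasMember⇒∈ℕ (outside ∷ A) h with hasMember⇒∈ℕ A h
... | x , x∈ = suc x , x∈

≤-max : ∀ (A : Subset n) → x ∈ℕ A → x ≤ max A
≤-max {x = zero}  (_ ∷ _) _ = z≤n
≤-max {x = suc x} (_ ∷ A) x∈ with hasMember A | ∈ℕ⇒hasMember A x∈
... | true | _ = s≤s (≤-max A x∈)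

max-∈ℕ : ∀ (A : Subset n) → x ∈ℕ A → max A ∈ℕ A
max-∈ℕ {x = x} (_ ∷ A) x∈ with hasMember A in h
... | true with hasMember⇒∈ℕ A h
...   | y , y∈ = max-∈ℕ A y∈
max-∈ℕ {x = zero}  (_ ∷ A) x∈ | false = x∈
max-∈ℕ {x = suc x} (_ ∷ A) x∈ | false with () ← trans (sym (∈ℕ⇒hasMember A x∈)) h

max-unique : ∀ (A : Subset n) → y ∈ℕ A → (∀ {x} → x ∈ℕ A → x ≤ y) → max A ≡ y
max-unique A y∈ below-y = ≤-antisym (below-y (max-∈ℕ A y∈)) (≤-max A y∈)

max≤ : ∀ (A : Subset (suc n)) → max A ≤ n
max≤ {zero}  (_ ∷ []) = z≤n
max≤ {suc n} (_ ∷ A) with hasMember A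
... | true  = s≤s (max≤ A)
... | false = z≤n

>max⇒∉ℕ : ∀ (A : Subset n) → max A < x → member A x ≡ false
>max⇒∉ℕ {x = x} A max<x with member A x in h
... | false = refl
... | true  = ⊥-elim (<⇒≱ max<x (≤-max A h))

infixl 6 _[_]≔_
_[_]≔_ : Subset n → ℕ → Side → Subset n
[]      [ _     ]≔ _ = []
(_ ∷ A) [ zero  ]≔ b = b ∷ A
(a ∷ A) [ suc x ]≔ b = a ∷ A [ x ]≔ b

member-[]≔-same : ∀ (A : Subset n) {b} → x < n → member (A [ x ]≔ b) x ≡ b
member-[]≔-same {x = zero}  (_ ∷ _) _         = refl
member-[]≔-same {x = suc x} (_ ∷ A) (s≤s x<n) = member-[]≔-same A x<n

member-[]≔-other : ∀ (A : Subset n) {b} → y ≢ x → member (A [ x ]≔ b) y ≡ member A y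
member-[]≔-other                   []      _   = refl
member-[]≔-other {y = zero}  {zero}  (_ ∷ _) y≢x = ⊥-elim (y≢x refl)
member-[]≔-other {y = suc y} {zero}  (_ ∷ _) _   = refl
member-[]≔-other {y = zero}  {suc x} (_ ∷ _) _   = refl
member-[]≔-other {y = suc y} {suc x} (_ ∷ A) y≢x = member-[]≔-other A (y≢x ∘ cong suc)

[]≔-injective : ∀ (A B : Subset n) {b} → A [ x ]≔ b ≡ B [ x ]≔ b →
                member A x ≡ member B x → A ≡ B
[]≔-injective                   []      []      _  _    = refl
[]≔-injective {x = zero}  (_ ∷ A) (_ ∷ B) eq refl = cong (_ ∷_) (∷-injectiveʳ eq)
[]≔-injective {x = suc x} (a ∷ A) (b ∷ B) eq eqₓ  with ∷-injective eq
... | refl , eq′ = cong (a ∷_) ([]≔-injective A B eq′ eqₓ)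

∈ℕ-[]≔inside⁻ : ∀ (A : Subset n) → x ∈ℕ A [ y ]≔ inside → x ≡ y ⊎ x ∈ℕ A
∈ℕ-[]≔inside⁻ {x = x} {y} A x∈ with x ≟ y
... | yes x≡y = inj₁ x≡y
... | no  x≢y = inj₂ (trans (sym (member-[]≔-other A x≢y)) x∈)

∈ℕ-[]≔outside⁻ : ∀ (A : Subset n) → x ∈ℕ A [ y ]≔ outside → x ≢ y × x ∈ℕ A
∈ℕ-[]≔outside⁻ {x = x} {y} A x∈ with x ≟ y
... | yes refl with () ← trans (sym x∈) (member-[]≔-same A (∈ℕ⇒< (A [ x ]≔ outside) x∈))
... | no  x≢y = x≢y , trans (sym (member-[]≔-other A x≢y)) x∈

max-[]≔inside : ∀ (A : Subset n) → y < n → (∀ {x} → x ∈ℕ A → x ≤ y) →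
                max (A [ y ]≔ inside) ≡ y
max-[]≔inside A y<n below-y = max-unique (A [ _ ]≔ inside) (member-[]≔-same A y<n) λ x∈ →
  [ ≤-reflexive , below-y ]′ (∈ℕ-[]≔inside⁻ A x∈)

widen : Subset n → Subset (suc n)
widen A = A ∷ʳ outside

member-widen : ∀ (A : Subset n) x → member (widen A) x ≡ member A x
member-widen []      zero    = refl
member-widen []      (suc x) = refl
member-widen (_ ∷ A) zero    = refl
member-widen (_ ∷ A) (suc x) = member-widen A x

∈ℕ-widen : ∀ (A : Subset n) → x ∈ℕ A → x ∈ℕ widen A
∈ℕ-widen {x = x} A = trans (member-widen A x)

∈ℕ-widen⁻ : ∀ (A : Subset n) → x ∈ℕ widen A → x ∈ℕ A
∈ℕ-widen⁻ {x = x} A = trans (sym (member-widen A x))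

hasMember-widen : ∀ (A : Subset n) → hasMember (widen A) ≡ hasMember A
hasMember-widen []      = refl
hasMember-widen (b ∷ A) = cong (b ∨_) (hasMember-widen A)

max-widen : ∀ (A : Subset n) → max (widen A) ≡ max A
max-widen []      = refl
max-widen (_ ∷ A) rewrite hasMember-widen A | max-widen A = refl

move : ℕ → ℕ → Subset n → Subset n
move x y A = A [ x ]≔ outside [ y ]≔ inside

∈ℕ-move-target : ∀ (A : Subset n) → y < n → y ∈ℕ move x y A
∈ℕ-move-target A = member-[]≔-same (A [ _ ]≔ outside)

∉ℕ-move-source : ∀ (A : Subset n) → x ≢ y → member (move x y A) x ≡ false
∉ℕ-move-source {x = x} A x≢y with x <? _
... | yes x<n = trans (member-[]≔-other (A [ x ]≔ outside) x≢y) (member-[]≔-same A x<n)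
... | no  x≮n = ≥⇒∉ℕ (move x _ A) (≮⇒≥ x≮n)

member-move-other : ∀ (A : Subset n) {z} → z ≢ x → z ≢ y → member (move x y A) z ≡ member A z
member-move-other A z≢x z≢y =
  trans (member-[]≔-other (A [ _ ]≔ outside) z≢y) (member-[]≔-other A z≢x)

max-move : ∀ (A : Subset n) → y < n → (∀ {z} → z ∈ℕ A → z ≢ x → z ≤ y) →
           max (move x y A) ≡ y
max-move A y<n below-y = max-[]≔inside (A [ _ ]≔ outside) y<n λ z∈ →
  let z≢x , z∈A = ∈ℕ-[]≔outside⁻ A z∈ in below-y z∈A z≢x

move-injective : ∀ (A B : Subset n) → move x y A ≡ move x y B → x ≢ y →
                 member A x ≡ member B x → member A y ≡ member B y → A ≡ B
move-injective {x = x} {y} A B eq x≢y eqₓ eqᵧ =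
  []≔-injective A B ([]≔-injective (A [ x ]≔ outside) (B [ x ]≔ outside) eq eq′) eqₓ
  where
  eq′ : member (A [ x ]≔ outside) y ≡ member (B [ x ]≔ outside) y
  eq′ = trans (member-[]≔-other A (x≢y ∘ sym)) (trans eqᵧ (sym (member-[]≔-other B (x≢y ∘ sym))))

atMost : ℕ → Subset n
atMost {zero}  _       = []
atMost {suc n} zero    = inside ∷ ∅
atMost {suc n} (suc t) = inside ∷ atMost t

∈ℕ-atMost : ∀ {t} → x ≤ t → x < n → x ∈ℕ atMost {n} t
∈ℕ-atMost {x = zero}  {t = zero}  _         (s≤s _)   = refl
∈ℕ-atMost {x = zero}  {t = suc t} _         (s≤s _)   = refl
∈ℕ-atMost {x = suc x} {t = suc t} (s≤s x≤t) (s≤s x<n) = ∈ℕ-atMost x≤t x<n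

∈ℕ-atMost⁻ : ∀ {t} → x ∈ℕ atMost {n} t → x ≤ t
∈ℕ-atMost⁻ {x = zero}                      _  = z≤n
∈ℕ-atMost⁻ {x = suc x} {suc n} {zero}  x∈ with () ← trans (sym x∈) (∉ℕ-∅ {n} x)
∈ℕ-atMost⁻ {x = suc x} {suc n} {suc t} x∈ = s≤s (∈ℕ-atMost⁻ {n = n} x∈)

max-atMost : ∀ {t} → t < n → max (atMost {n} t) ≡ t
max-atMost {n} {t} t<n = max-unique (atMost {n} t) (∈ℕ-atMost ≤-refl t<n) (∈ℕ-atMost⁻ {n = n})

-- Summands of an interval

headroom : Subset (suc m) → ℕ
headroom {m} A = m ∸ max A

CoveredBy : Subset (suc m) → ℕ → Set
CoveredBy A c = ∃[ a ] a ∈ℕ A × a ≤ c × c ≤ a + headroom A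

max+headroom : ∀ (A : Subset (suc m)) → max A + headroom A ≡ m
max+headroom A = m+[n∸m]≡n (max≤ A)

-- A + [0, m ∸ max A] = [0, m]. Any B with A + B = [0, m] lies in [0, m ∸ max A], so this
-- characterises the summands of [0, m].
Covers : Subset (suc m) → Set
Covers {m} A = ∀ {c} → c ≤ m → CoveredBy A c

module _ (A : Subset (suc m)) (cover : Covers A) where

  covers⇒0∈ℕ : 0 ∈ℕ A
  covers⇒0∈ℕ with cover z≤n
  ... | zero , 0∈ , _ = 0∈

  covers⇒max∈ℕ : max A ∈ℕ A
  covers⇒max∈ℕ = max-∈ℕ A covers⇒0∈ℕ

summand⇒covers : ∀ (A : Subset (suc m)) → IsSummand ⊤ A → Covers A
summand⇒covers {m} A (B , closed , decompose) {c} c≤m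
  with decompose (fromℕ< (s≤s c≤m)) ∈⊤
... | a , b , a∈ , b∈ , a+b≡ = toℕ a , ∈⇒∈ℕ a∈ , a≤c , c≤a+headroom
  where
  a+b≡c : toℕ a + toℕ b ≡ c
  a+b≡c = trans a+b≡ (toℕ-fromℕ< (s≤s c≤m))
  a≤c : toℕ a ≤ c
  a≤c = subst (toℕ a ≤_) a+b≡c (m≤m+n (toℕ a) (toℕ b))
  max+b≤m : max A + toℕ b ≤ m
  max+b≤m with ∈ℕ⇒∃∈ A (max-∈ℕ A (∈⇒∈ℕ a∈))
  ... | i , i∈ , i≡max with closed i b i∈ b∈
  ...   | d , _ , i+b≡d = subst (λ x → x + toℕ b ≤ m) i≡max
                            (≤-pred (subst (_< suc m) (sym i+b≡d) (toℕ<n d)))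
  c≤a+headroom : c ≤ toℕ a + headroom A
  c≤a+headroom = subst (_≤ toℕ a + headroom A) a+b≡c
    (+-monoʳ-≤ (toℕ a) (m+n≤o⇒m≤o∸n (toℕ b) (subst (_≤ m) (+-comm (max A) (toℕ b)) max+b≤m)))

covers⇒summand : ∀ (A : Subset (suc m)) → Covers A → IsSummand ⊤ A
covers⇒summand {m} A cover = B , closed , decompose
  where
  B : Subset (suc m)
  B = atMost (headroom A)
  closed : ∀ a b → a ∈ A → b ∈ B → ∃[ c ] c ∈ ⊤ × toℕ a + toℕ b ≡ toℕ c
  closed a b a∈ b∈ = fromℕ< a+b<1+m , ∈⊤ , sym (toℕ-fromℕ< a+b<1+m)
    where
    a+b<1+m : toℕ a + toℕ b < suc m
    a+b<1+m = s≤s (begin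
      toℕ a + toℕ b       ≤⟨ +-mono-≤ (≤-max A (∈⇒∈ℕ a∈)) (∈ℕ-atMost⁻ {n = suc m} (∈⇒∈ℕ b∈)) ⟩
      max A + headroom A  ≡⟨ max+headroom A ⟩
      m                   ∎)
      where open ≤-Reasoning
  decompose : ∀ c → c ∈ ⊤ → ∃[ a ] ∃[ b ] a ∈ A × b ∈ B × toℕ a + toℕ b ≡ toℕ c
  decompose c _ with cover (≤-pred (toℕ<n c))
  ... | a , a∈ , a≤c , c≤a+h with ∈ℕ⇒∃∈ A a∈ | ∈ℕ⇒∃∈ B (∈ℕ-atMost c∸a≤h c∸a<1+m)
    where
    c∸a≤h = m≤n+o⇒m∸n≤o (toℕ c) a c≤a+h
    c∸a<1+m = s≤s (≤-trans c∸a≤h (m∸n≤m m (max A)))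
  ... | i , i∈ , i≡a | j , j∈ , j≡c∸a =
    i , j , i∈ , j∈ , trans (cong₂ _+_ i≡a j≡c∸a) (m+[n∸m]≡n a≤c)

covers-above-max : ∀ (A : Subset (suc m)) → max A ∈ℕ A →
                   (∀ {c} → c < max A → CoveredBy A c) → Covers A
covers-above-max {m} A max∈ covered-below {c} c≤m with c <? max A
... | yes c<max = covered-below c<max
... | no  c≮max = max A , max∈ , ≮⇒≥ c≮max , subst (c ≤_) (sym (max+headroom A)) c≤m

covered-transfer : ∀ {m′} (A : Subset (suc m)) (A′ : Subset (suc m′)) →
                   headroom A ≤ headroom A′ → (∀ {a} → a ≤ c → a ∈ℕ A → a ∈ℕ A′) →
                   CoveredBy A c → CoveredBy A′ c
covered-transfer A A′ h≤h′ keep (a , a∈ , a≤c , c≤) =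
  a , keep a≤c a∈ , a≤c , ≤-trans c≤ (+-monoʳ-≤ a h≤h′)

covers-atMost : ∀ {t} → t ≤ m → Covers (atMost {suc m} t)
covers-atMost {m} {t} t≤m = covers-above-max B max∈ λ {c} c<max →
  let c≤t = <⇒≤ (subst (c <_) max≡t c<max) in
  c , ∈ℕ-atMost c≤t (s≤s (≤-trans c≤t t≤m)) , ≤-refl , m≤m+n c _
  where
  B = atMost {suc m} t
  max≡t : max B ≡ t
  max≡t = max-atMost (s≤s t≤m)
  max∈ : max B ∈ℕ B
  max∈ = subst (_∈ℕ B) (sym max≡t) (∈ℕ-atMost ≤-refl (s≤s t≤m))

-- The maximum is covered by a smaller element as well, so it can be moved up by one.
Slack : Subset (suc m) → Set
Slack A = max A ≡ 0 ⊎ ∃[ p ] p < max A × (p ∈ℕ A × max A ≤ p + headroom A)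

slack? : Decidable (Slack {m})
slack? A = (max A ≟ 0) ⊎-dec
  anyUpTo? (λ p → (member A p Bool.≟ true) ×-dec (max A ≤? p + headroom A)) (max A)

module _ (A : Subset (suc m)) (tight : ¬ Slack A) where

  tight⇒suc-pred-max : suc (pred (max A)) ≡ max A
  tight⇒suc-pred-max with max A
  ... | zero  = contradiction (inj₁ refl) tight
  ... | suc _ = refl

  tight⇒max≢pred-max : max A ≢ pred (max A)
  tight⇒max≢pred-max eq = <⇒≢ (n<1+n _) (trans (sym eq) (sym tight⇒suc-pred-max))

  tight⇒gap : ∀ {p} → p < max A → p ∈ℕ A → p + headroom A < max A
  tight⇒gap {p} p<max p∈ = ≰⇒> λ max≤ → tight (inj₂ (p , p<max , p∈ , max≤))

tight⇒witness : ∀ (A : Subset (suc m)) → Covers A → ¬ Slack A →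
                ∃[ p ] p ∈ℕ A × p + headroom A ≡ pred (max A)
tight⇒witness A cover tight with cover (≤-trans pred[n]≤n (max≤ A))
... | p , p∈ , p≤ , ≤p+h = p , p∈ , ≤-antisym p+h≤ ≤p+h
  where
  p<max : p < max A
  p<max = subst (p <_) (tight⇒suc-pred-max A tight) (s≤s p≤)
  p+h≤ : p + headroom A ≤ pred (max A)
  p+h≤ = ≤-pred (subst (p + headroom A <_) (sym (tight⇒suc-pred-max A tight))
                       (tight⇒gap A tight p<max p∈))

covers⇒headroom≡0⇒⊤ : ∀ (A : Subset (suc m)) → Covers A → headroom A ≡ 0 → A ≡ ⊤
covers⇒headroom≡0⇒⊤ {m} A cover h≡0 = all-∈ℕ⇒⊤ A ∈ℕA
  where
  ∈ℕA : ∀ {c} → c < suc m → c ∈ℕ A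
  ∈ℕA {c} c<1+m with cover (≤-pred c<1+m)
  ... | a , a∈ , a≤c , c≤a+h = subst (_∈ℕ A) (≤-antisym a≤c c≤a) a∈
    where
    c≤a : c ≤ a
    c≤a = subst (c ≤_) (trans (cong (a +_) h≡0) (+-identityʳ a)) c≤a+h

TopAdjacent : ∀ {n} → Subset n → Set
TopAdjacent A = 1 ≤ max A × pred (max A) ∈ℕ A

topAdjacent? : ∀ {n} → Decidable (TopAdjacent {n})
topAdjacent? A = (1 ≤? max A) ×-dec (member A (pred (max A)) Bool.≟ true)

-- Three injections between summands

extendTop : Subset (suc m) → Subset (suc (suc m))
extendTop A = widen A [ suc (max A) ]≔ inside

module _ (A : Subset (suc m)) where

  private
    top< : suc (max A) < suc (suc m)
    top< = s≤s (s≤s (max≤ A))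

  ∈ℕ-extendTop : x ∈ℕ A → x ∈ℕ extendTop A
  ∈ℕ-extendTop x∈ =
    trans (member-[]≔-other (widen A) (<⇒≢ (s≤s (≤-max A x∈)))) (∈ℕ-widen A x∈)

  max-extendTop : max (extendTop A) ≡ suc (max A)
  max-extendTop = max-[]≔inside (widen A) top< λ x∈ → m≤n⇒m≤1+n (≤-max A (∈ℕ-widen⁻ A x∈))

  covers-extendTop : Covers A → Covers (extendTop A)
  covers-extendTop cover = covers-above-max (extendTop A) top∈ λ {c} c<max →
    covered-transfer A (extendTop A) (≤-reflexive (cong (suc m ∸_) (sym max-extendTop)))
      (λ _ → ∈ℕ-extendTop) (cover (≤-trans (≤-pred (subst (c <_) max-extendTop c<max)) (max≤ A)))
    where
    top∈ : max (extendTop A) ∈ℕ extendTop A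
    top∈ = subst (_∈ℕ extendTop A) (sym max-extendTop) (member-[]≔-same (widen A) top<)

  topAdjacent-extendTop : Covers A → TopAdjacent (extendTop A)
  topAdjacent-extendTop cover rewrite max-extendTop = s≤s z≤n , ∈ℕ-extendTop (covers⇒max∈ℕ A cover)

extendTop-injective : ∀ (A B : Subset (suc m)) → extendTop A ≡ extendTop B → A ≡ B
extendTop-injective A B eq =
  ∷ʳ-injectiveˡ A B ([]≔-injective (widen A) (widen B) eq′ (trans top∉A (sym top∉B)))
  where
  max≡ : max A ≡ max B
  max≡ = suc-injective (trans (sym (max-extendTop A)) (trans (cong max eq) (max-extendTop B)))
  eq′ : widen A [ suc (max B) ]≔ inside ≡ widen B [ suc (max B) ]≔ inside
  eq′ = subst (λ k → widen A [ suc k ]≔ inside ≡ extendTop B) max≡ eq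
  top∉A : member (widen A) (suc (max B)) ≡ false
  top∉A = trans (member-widen A _) (>max⇒∉ℕ A (s≤s (≤-reflexive max≡)))
  top∉B : member (widen B) (suc (max B)) ≡ false
  top∉B = trans (member-widen B _) (>max⇒∉ℕ B ≤-refl)

raiseTopAt : ℕ → Subset (suc m) → Subset (suc (suc m))
raiseTopAt zero    A = widen A
raiseTopAt (suc k) A = move (suc k) (suc (suc k)) (widen A)

raiseTop : Subset (suc m) → Subset (suc (suc m))
raiseTop A = raiseTopAt (max A) A

module _ (A : Subset (suc m)) {k} (max≡ : max A ≡ suc k) where

  private
    top< : suc (suc k) < suc (suc m)
    top< = s≤s (s≤s (subst (_≤ m) max≡ (max≤ A)))

  max-raiseTopAt : max (raiseTopAt (suc k) A) ≡ suc (suc k)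
  max-raiseTopAt = max-move (widen A) top< λ z∈ _ →
    m≤n⇒m≤1+n (subst (_ ≤_) max≡ (≤-max A (∈ℕ-widen⁻ A z∈)))

  top∈widen : Covers A → suc k ∈ℕ widen A
  top∈widen cover = ∈ℕ-widen A (subst (_∈ℕ A) max≡ (covers⇒max∈ℕ A cover))

  above-top∉widen : member (widen A) (suc (suc k)) ≡ false
  above-top∉widen = trans (member-widen A _) (>max⇒∉ℕ A (s≤s (≤-reflexive max≡)))

  ∈ℕ-raiseTopAt : x < max A → x ∈ℕ A → x ∈ℕ raiseTopAt (suc k) A
  ∈ℕ-raiseTopAt x<max x∈ =
    trans (member-move-other (widen A) (<⇒≢ x<k′) (<⇒≢ (m<n⇒m<1+n x<k′))) (∈ℕ-widen A x∈)
    where x<k′ = subst (_ <_) max≡ x<max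

  covers-raiseTopAt : Covers A → Slack A → Covers (raiseTopAt (suc k) A)
  covers-raiseTopAt cover (inj₁ max≡0) = contradiction (trans (sym max≡) max≡0) λ ()
  covers-raiseTopAt cover (inj₂ (p , p<max , p∈ , max≤p+h)) =
    covers-above-max A′ top∈ λ {c} c<max′ → covered-below (≤-pred (subst (c <_) max-raiseTopAt c<max′))
    where
    A′ = raiseTopAt (suc k) A
    top∈ : max A′ ∈ℕ A′
    top∈ = subst (_∈ℕ A′) (sym max-raiseTopAt) (∈ℕ-move-target (widen A) top<)
    headroom≡ : headroom A ≡ headroom A′
    headroom≡ = trans (cong (m ∸_) max≡) (cong (suc m ∸_) (sym max-raiseTopAt))
    covered-below : ∀ {c} → c ≤ suc k → CoveredBy A′ c
    covered-below {c} c≤k′ with m≤n⇒m<n∨m≡n c≤k′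
    ... | inj₁ c<k′ = covered-transfer A A′ (≤-reflexive headroom≡)
      (λ a≤c → ∈ℕ-raiseTopAt (subst (_ <_) (sym max≡) (≤-<-trans a≤c c<k′)))
      (cover (≤-trans (<⇒≤ c<k′) (subst (_≤ m) max≡ (max≤ A))))
    ... | inj₂ refl = p , ∈ℕ-raiseTopAt p<max p∈ , <⇒≤ (subst (p <_) max≡ p<max) ,
      subst₂ (λ u v → u ≤ p + v) max≡ headroom≡ max≤p+h

  ¬topAdjacent-raiseTopAt : ¬ TopAdjacent (raiseTopAt (suc k) A)
  ¬topAdjacent-raiseTopAt (_ , pred-max∈) with () ← trans
    (sym (subst (λ z → pred z ∈ℕ raiseTopAt (suc k) A) max-raiseTopAt pred-max∈))
    (∉ℕ-move-source (widen A) (<⇒≢ (n<1+n _)))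

module _ (A : Subset (suc m)) (max≡0 : max A ≡ 0) where

  private
    max′≡0 : max (widen A) ≡ 0
    max′≡0 = trans (max-widen A) max≡0

  covers-raiseTopAt-zero : Covers A → Covers (raiseTopAt zero A)
  covers-raiseTopAt-zero cover = covers-above-max (widen A)
    (subst (_∈ℕ widen A) (sym max′≡0) (∈ℕ-widen A (covers⇒0∈ℕ A cover)))
    λ c<max → contradiction (subst (_ <_) max′≡0 c<max) λ ()

  ¬topAdjacent-raiseTopAt-zero : ¬ TopAdjacent (raiseTopAt zero A)
  ¬topAdjacent-raiseTopAt-zero (1≤max , _) = contradiction (subst (1 ≤_) max′≡0 1≤max) λ ()

module _ (A : Subset (suc m)) where

  covers-raiseTop : Covers A → Slack A → Covers (raiseTop A)
  covers-raiseTop cover slack = go (max A) refl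
    where
    go : ∀ k → max A ≡ k → Covers (raiseTopAt k A)
    go zero    max≡ = covers-raiseTopAt-zero A max≡ cover
    go (suc k) max≡ = covers-raiseTopAt A max≡ cover slack

  ¬topAdjacent-raiseTop : ¬ TopAdjacent (raiseTop A)
  ¬topAdjacent-raiseTop = go (max A) refl
    where
    go : ∀ k → max A ≡ k → ¬ TopAdjacent (raiseTopAt k A)
    go zero    max≡ = ¬topAdjacent-raiseTopAt-zero A max≡
    go (suc k) max≡ = ¬topAdjacent-raiseTopAt A max≡

raiseTop-injective : ∀ (A B : Subset (suc m)) → Covers A → Covers B → raiseTop A ≡ raiseTop B → A ≡ B
raiseTop-injective A B cA cB = go (max A) (max B) refl refl
  where
  go : ∀ k l → max A ≡ k → max B ≡ l → raiseTopAt k A ≡ raiseTopAt l B → A ≡ B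
  go zero zero _ _ eq = ∷ʳ-injectiveˡ A B eq
  go zero (suc l) max≡ max≡′ eq = contradiction
    (trans (sym (max-raiseTopAt B max≡′)) (trans (cong max (sym eq)) (trans (max-widen A) max≡))) λ ()
  go (suc k) zero max≡ max≡′ eq = contradiction
    (trans (sym (max-raiseTopAt A max≡)) (trans (cong max eq) (trans (max-widen B) max≡′))) λ ()
  go (suc k) (suc l) max≡ max≡′ eq
    with suc-injective (suc-injective
           (trans (sym (max-raiseTopAt A max≡)) (trans (cong max eq) (max-raiseTopAt B max≡′))))
  ... | refl = ∷ʳ-injectiveˡ A B (move-injective (widen A) (widen B) eq (<⇒≢ (n<1+n _))
    (trans (top∈widen A max≡ cA) (sym (top∈widen B max≡′ cB)))
    (trans (above-top∉widen A max≡) (sym (above-top∉widen B max≡′))))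

-- Headroom 0 forces A = [0, m] (covers⇒headroom≡0⇒⊤), which is sent to {0}.
lowerTopAt : ℕ → Subset (suc m) → Subset (suc m)
lowerTopAt zero    _ = atMost 0
lowerTopAt (suc _) A = move (max A) (pred (max A)) A

lowerTop : Subset (suc m) → Subset (suc m)
lowerTop A = lowerTopAt (headroom A) A

module _ (A : Subset (suc m)) (cover : Covers A) (tight : ¬ Slack A)
         {s} (headroom≡ : headroom A ≡ suc s) where

  private
    k = pred (max A)
    A′ = lowerTopAt (suc s) A

    k′≡max : suc k ≡ max A
    k′≡max = tight⇒suc-pred-max A tight

    k<max : k < max A
    k<max = subst (k <_) k′≡max ≤-refl

    k<1+m : k < suc m
    k<1+m = ≤-trans k<max (m≤n⇒m≤1+n (max≤ A))

    k′+s′≡m : suc k + suc s ≡ m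
    k′+s′≡m = subst₂ (λ u v → u + v ≡ m) (sym k′≡max) headroom≡ (max+headroom A)

  max-lowerTopAt : max A′ ≡ k
  max-lowerTopAt = max-move A k<1+m λ z∈ z≢max →
    ≤-pred (subst (_ <_) (sym k′≡max) (≤∧≢⇒< (≤-max A z∈) z≢max))

  private
    headroom≤ : headroom A ≤ headroom A′
    headroom≤ = subst (λ z → m ∸ max A ≤ m ∸ z) (sym max-lowerTopAt) (∸-monoʳ-≤ m (<⇒≤ k<max))

  ∈ℕ-lowerTopAt : x < k → x ∈ℕ A → x ∈ℕ A′
  ∈ℕ-lowerTopAt x<k x∈ = trans (member-move-other A (<⇒≢ (<-trans x<k k<max)) (<⇒≢ x<k)) x∈

  ∉ℕ-pred-max : member A k ≡ false
  ∉ℕ-pred-max with member A k in k∈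
  ... | false = refl
  ... | true  = ⊥-elim (<⇒≱ (tight⇒gap A tight k<max k∈) (begin
    max A             ≡⟨ sym k′≡max ⟩
    suc k             ≤⟨ s≤s (m≤m+n k s) ⟩
    suc (k + s)       ≡⟨ sym (+-suc k s) ⟩
    k + suc s         ≡⟨ cong (k +_) (sym headroom≡) ⟩
    k + headroom A    ∎))
    where open ≤-Reasoning

  covers-lowerTopAt : Covers A′
  covers-lowerTopAt = covers-above-max A′ top∈ λ {c} c<max′ →
    let c<k = subst (c <_) max-lowerTopAt c<max′ in
    covered-transfer A A′ headroom≤ (λ a≤c → ∈ℕ-lowerTopAt (≤-<-trans a≤c c<k))
      (cover (≤-trans (<⇒≤ (<-trans c<k k<max)) (max≤ A)))
    where
    top∈ : max A′ ∈ℕ A′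
    top∈ = subst (_∈ℕ A′) (sym max-lowerTopAt) (∈ℕ-move-target A k<1+m)

  slack-lowerTopAt : Slack A′
  slack-lowerTopAt with tight⇒witness A cover tight
  ... | p , p∈ , p+h≡k = inj₂ (p , subst (p <_) (sym max-lowerTopAt) p<k , ∈ℕ-lowerTopAt p<k p∈ ,
      subst (_≤ p + headroom A′) (trans p+h≡k (sym max-lowerTopAt)) (+-monoʳ-≤ p headroom≤))
    where
    p<k : p < k
    p<k = subst (p <_) p+h≡k (subst (λ h → p < p + h) (sym headroom≡) (m<m+n p z<s))

  max-lowerTopAt≤ : max A′ ≤ m ∸ 2
  max-lowerTopAt≤ = subst (_≤ m ∸ 2) (sym max-lowerTopAt) (m+n≤o⇒m≤o∸n k (begin
    k + 2             ≤⟨ +-monoʳ-≤ k (s≤s (s≤s z≤n)) ⟩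
    k + suc (suc s)   ≡⟨ +-suc k (suc s) ⟩
    suc k + suc s     ≡⟨ k′+s′≡m ⟩
    m                 ∎))
    where open ≤-Reasoning

  max-lowerTopAt>0 : 0 < max A′
  max-lowerTopAt>0 with tight⇒witness A cover tight
  ... | p , _ , p+h≡k = subst (0 <_) (trans p+h≡k (sym max-lowerTopAt))
    (subst (λ h → 0 < p + h) (sym headroom≡) (<-≤-trans z<s (m≤n+m (suc s) p)))

module _ (A : Subset (suc m)) (cover : Covers A) (tight : ¬ Slack A) where

  covers-lowerTop : Covers (lowerTop A)
  covers-lowerTop = go (headroom A) refl
    where
    go : ∀ s → headroom A ≡ s → Covers (lowerTopAt s A)
    go zero    _  = covers-atMost z≤n
    go (suc s) h≡ = covers-lowerTopAt A cover tight h≡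

  slack-lowerTop : Slack (lowerTop A)
  slack-lowerTop = go (headroom A) refl
    where
    go : ∀ s → headroom A ≡ s → Slack (lowerTopAt s A)
    go zero    _  = inj₁ (max-atMost {suc m} z<s)
    go (suc s) h≡ = slack-lowerTopAt A cover tight h≡

  max-lowerTop≤ : max (lowerTop A) ≤ m ∸ 2
  max-lowerTop≤ = go (headroom A) refl
    where
    go : ∀ s → headroom A ≡ s → max (lowerTopAt s A) ≤ m ∸ 2
    go zero    _  = subst (_≤ m ∸ 2) (sym (max-atMost {suc m} z<s)) z≤n
    go (suc s) h≡ = max-lowerTopAt≤ A cover tight h≡

lowerTop-injective : ∀ (A B : Subset (suc m)) → Covers A → ¬ Slack A → Covers B → ¬ Slack B →
                     lowerTop A ≡ lowerTop B → A ≡ B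
lowerTop-injective {m} A B cA tA cB tB = go (headroom A) (headroom B) refl refl
  where
  go : ∀ s t → headroom A ≡ s → headroom B ≡ t → lowerTopAt s A ≡ lowerTopAt t B → A ≡ B
  go zero zero hA hB _ = trans (covers⇒headroom≡0⇒⊤ A cA hA) (sym (covers⇒headroom≡0⇒⊤ B cB hB))
  go zero (suc t) _ hB eq = contradiction (trans (cong max (sym eq)) (max-atMost {suc m} z<s))
    (≢-sym (<⇒≢ (max-lowerTopAt>0 B cB tB hB)))
  go (suc s) zero hA _ eq = contradiction (trans (cong max eq) (max-atMost {suc m} z<s))
    (≢-sym (<⇒≢ (max-lowerTopAt>0 A cA tA hA)))
  go (suc s) (suc t) hA hB eq = move-injective A B eq′ (tight⇒max≢pred-max A tA)
    (trans (covers⇒max∈ℕ A cA) (sym (subst (_∈ℕ B) (sym max≡) (covers⇒max∈ℕ B cB))))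
    (trans (∉ℕ-pred-max A cA tA hA) (sym (subst (λ M → member B (pred M) ≡ false) (sym max≡)
      (∉ℕ-pred-max B cB tB hB))))
    where
    pred≡ : pred (max A) ≡ pred (max B)
    pred≡ = trans (sym (max-lowerTopAt A cA tA hA)) (trans (cong max eq) (max-lowerTopAt B cB tB hB))
    max≡ : max A ≡ max B
    max≡ = trans (sym (tight⇒suc-pred-max A tA)) (trans (cong suc pred≡) (tight⇒suc-pred-max B tB))
    eq′ : lowerTopAt (suc s) A ≡ move (max A) (pred (max A)) B
    eq′ = subst (λ M → lowerTopAt (suc s) A ≡ move M (pred M) B) (sym max≡) eq

-- The recurrence 3 d[ m ] ≤ 2 d[ m + 1 ]

Summand : ∀ {n} → Subset n → Set
Summand = IsSummand ⊤

summand? : ∀ {n} → Decidable (Summand {n})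
summand? = isSummand? ⊤

#slack #tight #adjacent #separated : ℕ → ℕ
#slack     m = count (summand? ∩? slack? {m})
#tight     m = count (summand? ∩? ∁? (slack? {m}))
#adjacent  m = count (summand? ∩? topAdjacent? {suc m})
#separated m = count (summand? ∩? ∁? (topAdjacent? {suc m}))

module _ {m : ℕ} where

  private
    covers : ∀ {A : Subset (suc m)} → Summand A → Covers A
    covers {A} = summand⇒covers A

  d≤#adjacent : d[ m ] ≤ #adjacent (suc m)
  d≤#adjacent = count-≤ summand? (summand? ∩? topAdjacent?) extendTop
    (λ {A} sA → covers⇒summand _ (covers-extendTop A (covers sA)) , topAdjacent-extendTop A (covers sA))
    (λ _ _ → extendTop-injective _ _)

  #slack≤#separated : #slack m ≤ #separated (suc m)
  #slack≤#separated = count-≤ (summand? ∩? slack?) (summand? ∩? ∁? topAdjacent?) raiseTop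
    (λ {A} (sA , slack) → covers⇒summand _ (covers-raiseTop A (covers sA) slack) , ¬topAdjacent-raiseTop A)
    (λ (sA , _) (sB , _) → raiseTop-injective _ _ (covers sA) (covers sB))

  lowerTop-tight⇒slack : ∀ {A : Subset (suc m)} → (Summand ∩ ∁ Slack) A → (Summand ∩ Slack) (lowerTop A)
  lowerTop-tight⇒slack {A} (sA , tA) =
    covers⇒summand _ (covers-lowerTop A (covers sA) tA) , slack-lowerTop A (covers sA) tA

  lowerTop-injective-on-tight : ∀ {A B : Subset (suc m)} → (Summand ∩ ∁ Slack) A →
                                (Summand ∩ ∁ Slack) B → lowerTop A ≡ lowerTop B → A ≡ B
  lowerTop-injective-on-tight (sA , tA) (sB , tB) = lowerTop-injective _ _ (covers sA) tA (covers sB) tB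

  #tight≤#slack : #tight m ≤ #slack m
  #tight≤#slack = count-≤ (summand? ∩? ∁? slack?) (summand? ∩? slack?) lowerTop
    lowerTop-tight⇒slack lowerTop-injective-on-tight

#tight<#slack : ∀ n → #tight (2 + n) < #slack (2 + n)
#tight<#slack n = count-< (summand? ∩? ∁? slack?) (summand? ∩? slack?) lowerTop
  lowerTop-tight⇒slack lowerTop-injective-on-tight
  (covers⇒summand W (covers-atMost (n≤1+n _)) , slack-W)
  λ {A} (sA , tA) lowerTop≡W →
    ≤⇒≯ (subst (λ B → max B ≤ n) lowerTop≡W (max-lowerTop≤ A (summand⇒covers A sA) tA)) n<max-W
  where
  W : Subset (3 + n)
  W = atMost (suc n)
  max-W : max W ≡ suc n
  max-W = max-atMost (m≤n⇒m≤1+n ≤-refl)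
  n<max-W : n < max W
  n<max-W = subst (n <_) (sym max-W) ≤-refl
  headroom-W : headroom W ≡ 1
  headroom-W = trans (cong (2 + n ∸_) max-W) (m+n∸n≡m 1 (suc n))
  slack-W : Slack W
  slack-W = inj₂ (n , n<max-W , ∈ℕ-atMost (n≤1+n n) (m≤n⇒m≤1+n (n≤1+n _)) ,
    subst₂ (λ u v → u ≤ n + v) (sym max-W) (sym headroom-W) (≤-reflexive (+-comm 1 n)))

three-halves : ∀ {d d′ s t a b} e → d ≡ s + t → d′ ≡ a + b → d ≤ a → s ≤ b → e + t ≤ s →
               e + 3 * d ≤ 2 * d′
three-halves {s = s} {t} {a} {b} e refl refl d≤a s≤b e+t≤s = begin
  e + 3 * (s + t)             ≡⟨ lhs≡ e s t ⟩
  2 * (s + t) + (s + (e + t)) ≤⟨ +-monoʳ-≤ (2 * (s + t)) (+-monoʳ-≤ s e+t≤s) ⟩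
  2 * (s + t) + (s + s)       ≡⟨ rhs≡ (s + t) s ⟩
  2 * ((s + t) + s)           ≤⟨ *-monoʳ-≤ 2 (+-mono-≤ d≤a s≤b) ⟩
  2 * (a + b)                 ∎
  where
  open ≤-Reasoning
  lhs≡ : ∀ e s t → e + 3 * (s + t) ≡ 2 * (s + t) + (s + (e + t))
  lhs≡ = solve-∀
  rhs≡ : ∀ d s → 2 * d + (s + s) ≡ 2 * (d + s)
  rhs≡ = solve-∀

d≡#slack+#tight : ∀ m → d[ m ] ≡ #slack m + #tight m
d≡#slack+#tight m = count-split summand? (slack? {m})

d≡#adjacent+#separated : ∀ m → d[ m ] ≡ #adjacent m + #separated m
d≡#adjacent+#separated m = count-split summand? (topAdjacent? {suc m})

d-step : ∀ m → 3 * d[ m ] ≤ 2 * d[ suc m ]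
d-step m = three-halves 0 (d≡#slack+#tight m) (d≡#adjacent+#separated (suc m))
  (d≤#adjacent {m}) (#slack≤#separated {m}) (#tight≤#slack {m})

d-step-strict : ∀ m → m ≢ 1 → 3 * d[ m ] < 2 * d[ suc m ]
-- d[ 0 ] = 1 and d[ 1 ] = 2, by evaluation.
d-step-strict zero          _   = ≤-refl
d-step-strict (suc zero)    1≢1 = contradiction refl 1≢1
d-step-strict (suc (suc n)) _   = three-halves 1 (d≡#slack+#tight (2 + n)) (d≡#adjacent+#separated (3 + n))
  (d≤#adjacent {2 + n}) (#slack≤#separated {2 + n}) (#tight<#slack n)

d-step-≡ : ∀ m → 3 * d[ m ] ≡ 2 * d[ suc m ] ⇔ m ≡ 1
d-step-≡ m = mk⇔ (λ eq → decidable-stable (m ≟ 1) λ m≢1 → <⇒≢ (d-step-strict m m≢1) eq)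
  -- d[ 1 ] = 2 and d[ 2 ] = 3, by evaluation.
  λ where refl → refl

d-positive : ∀ m → 1 ≤ d[ m ]
d-positive m = count-positive summand? (covers⇒summand (atMost 0) (covers-atMost {m} z≤n))

-- Iterating the recurrence

module Ratio (f : ℕ → ℕ) (positive : ∀ n → 1 ≤ f n)
             (step : ∀ n → 3 * f n ≤ 2 * f (suc n))
             (step-≡ : ∀ n → 3 * f n ≡ 2 * f (suc n) ⇔ n ≡ 1) where

  private
    raise : ∀ i n → (2 + i + 1) * f n ≤ 2 * f (suc (i + n)) → (3 + i + 1) * f n < 2 * f (suc (suc (i + n)))
    raise i n hyp = *-cancelˡ-< 2 _ _ (begin-strict
      2 * ((3 + i + 1) * X)                 <⟨ m<m+n _ (≤-trans (positive n) (m≤m+n X (i * X))) ⟩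
      2 * ((3 + i + 1) * X) + (1 + i) * X   ≡⟨ identity i X ⟩
      3 * ((2 + i + 1) * X)                 ≤⟨ *-monoʳ-≤ 3 hyp ⟩
      3 * (2 * Y)                           ≡⟨ *-comm-3-2 Y ⟩
      2 * (3 * Y)                           ≤⟨ *-monoʳ-≤ 2 (step (suc (i + n))) ⟩
      2 * (2 * Z)                           ∎)
      where
      open ≤-Reasoning
      X = f n
      Y = f (suc (i + n))
      Z = f (suc (suc (i + n)))
      identity : ∀ i X → 2 * ((3 + i + 1) * X) + (1 + i) * X ≡ 3 * ((2 + i + 1) * X)
      identity = solve-∀
      *-comm-3-2 : ∀ Y → 3 * (2 * Y) ≡ 2 * (3 * Y)
      *-comm-3-2 = solve-∀

  ratio-≤ : ∀ j n → 1 ≤ j → (j + 1) * f n ≤ 2 * f (j + n ∸ 1)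
  ratio-≤ 1                   n _ = ≤-refl
  ratio-≤ 2                   n _ = step n
  ratio-≤ (suc (suc (suc i))) n _ = <⇒≤ (raise i n (ratio-≤ (suc (suc i)) n (s≤s z≤n)))

  ratio-< : ∀ i n → (3 + i + 1) * f n < 2 * f (3 + i + n ∸ 1)
  ratio-< i n = raise i n (ratio-≤ (2 + i) n (s≤s z≤n))

  ratio-≡ : ∀ j n → 1 ≤ j →
            ((j + 1) * f n ≡ 2 * f (j + n ∸ 1)) ⇔ (j ≡ 1 ⊎ (j + n ≡ 3 × j ≡ 2))
  ratio-≡ 1 n _ = mk⇔ (λ _ → inj₁ refl) (λ _ → refl)
  ratio-≡ 2 n _ = mk⇔ (λ eq → inj₂ (cong (2 +_) (Equivalence.to (step-≡ n) eq) , refl)) λ where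
    (inj₁ ())
    (inj₂ (2+n≡3 , _)) → Equivalence.from (step-≡ n) (suc-injective (suc-injective 2+n≡3))
  ratio-≡ (suc (suc (suc i))) n _ = mk⇔ (λ eq → contradiction eq (<⇒≢ (ratio-< i n))) λ where
    (inj₁ ())
    (inj₂ (_ , ()))

  ratio : ∀ j k → 1 ≤ j → j ≤ k →
          ((j + 1) * f (k ∸ j) ≤ 2 * f (k ∸ 1))
          × (((j + 1) * f (k ∸ j) ≡ 2 * f (k ∸ 1)) ⇔ (j ≡ 1 ⊎ (k ≡ 3 × j ≡ 2)))
  ratio j k 1≤j j≤k with m≤n⇒∃[o]m+o≡n j≤k
  ... | n , refl rewrite m+n∸m≡n j n = ratio-≤ j n 1≤j , ratio-≡ j n 1≤j

mainTheorem7 : (j k : ℕ) → 1 ≤ j → j ≤ k →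
    ((j + 1) * d[ k ∸ j ] ≤ 2 * d[ k ∸ 1 ])
    × (((j + 1) * d[ k ∸ j ] ≡ 2 * d[ k ∸ 1 ]) ⇔ (j ≡ 1 ⊎ (k ≡ 3 × j ≡ 2)))
mainTheorem7 = Ratio.ratio d[_] d-positive d-step d-step-≡
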